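{- Let $k\ge1$ and let $p,q$ be positive integers with canonical $k$-representations $p=\sum_i\binom{c_{k-i}}{k-i}$ and $q=\sum_i\binom{a_{k-i}}{k-i}$. Let $j$ be an integer with $j>c_k$ and $j>a_k$, let $m=p+q$, suppose $m\ge\binom{j}{k}$, and let $m-\binom{j}{k}=\sum_i\binom{b_{k-i}}{k-i}$ be its canonical $k$-representation (empty if this number is $0$). Then $$\binom{j}{k+1}+\sum_i\binom{b_{k-i}}{k+1-i}>\sum_i\binom{c_{k-i}}{k+1-i}+\sum_i\binom{a_{k-i}}{k+1-i}.$$
   Context: $\binom{n}{l}=0$ if $l>n$ or $l<0$. The canonical $k$-representation of a positive integer $p$ is the unique expression $p=\sum_{i=0}^s\binom{a_{k-i}}{k-i}$ with $s\ge0$ and $a_k>a_{k-1}>\dots>a_{k-s}\ge k-s>0$; the number $0$ is represented by the empty sequence, for which all such sums are $0$. Sums over $i$ run over the indices present in the respective representation. -}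

module Defs where

open import Data.Nat using (ℕ; zero; suc; _+_; _∸_; _≤_; _<_)
open import Data.Nat.Combinatorics using (_C_)
open import Data.List using (List; []; _∷_)
open import Data.Product using (_×_)
open import Data.Unit using (⊤)
open import Relation.Binary.PropositionalEquality using (_≡_)

-- A candidate k-representation is the list  a_k , a_{k-1} , … , a_{k-s}
-- (the i-th entry, counting from 0, is a_{k-i}).

-- repSum l (a_k ∷ … ∷ a_{k-s}) = Σ_i binom(a_{k-i}, l - i).
-- With l = k this is the represented number; with l = k+1 it is the
-- sum Σ_i binom(a_{k-i}, k+1-i) appearing in the lemma.
repSum : ℕ → List ℕ → ℕ
repSum l []       = 0
repSum l (a ∷ as) = (a C l) + repSum (l ∸ 1) as

CanonNE : ℕ → List ℕ → Set
CanonNE k []            = ⊤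
CanonNE k (a ∷ [])      = (0 < k) × (k ≤ a)
CanonNE k (a ∷ b ∷ as)  = (0 < k) × (b < a) × CanonNE (k ∸ 1) (b ∷ as)

IsCanonRep : ℕ → ℕ → List ℕ → Set
IsCanonRep k p []       = p ≡ 0
IsCanonRep k p (a ∷ as) = CanonNE k (a ∷ as) × (repSum k (a ∷ as) ≡ p)

module Submission where

-- For x ≤ binom(j,k) let upper k j x count the (k+1)-subsets of
-- {0,…,j-1} all of whose k-subsets are among the first x in colex order.  It
-- obeys a Pascal-type recursion in j, and on a canonical representation with
-- top entry below j it equals x^(k) (canonical-upper).  The theorem is then the
-- strict overflow property (O) of upper k j for p, q < binom(j,k).  (O) is
-- proved by induction on j, for all k at once, together with superadditivity
-- (P) and a tail inequality (T); a level-drop property (D) follows from (P).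
-- In the step, the colex list at level k+1 on {0,…,j} is split into its two
-- blocks and every case is reduced to the properties on {0,…,j-1}.

open import Defs
open import Data.Nat
  using (ℕ; zero; suc; _+_; _∸_; _⊓_; _≤_; _<_; _>_; _≤′_; ≤′-refl; ≤′-step; z≤n; s≤s; _≤?_; _<?_)
open import Data.Nat.Properties
open import Data.Nat.Induction using (<-rec)
open import Data.Nat.Combinatorics using (_C_; nCk+nC[k+1]≡[n+1]C[k+1])
open import Data.Sum using (inj₁; inj₂)
open import Data.List using (List; []; _∷_)
open import Data.Product using (_×_; _,_; ∃; proj₁; proj₂)
open import Data.Nat.Tactic.RingSolver using (solve-∀)
open import Algebra.Properties.CommutativeSemigroup +-commutativeSemigroup
  using (interchange; x∙yz≈y∙xz; x∙yz≈xz∙y; xy∙z≈x∙zy; xy∙z≈y∙xz; xy∙z≈xz∙y; xy∙z≈yz∙x; xy∙z≈zx∙y)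
open import Relation.Nullary using (yes; no)
open import Relation.Binary.PropositionalEquality

-- Pascal's triangle.  It agrees with the library's _C_ (bin≡C), but
-- unfolds definitionally along  bin (j+1) (k+1) = bin j k + bin j (k+1),
-- the recursion on which the whole induction is built.
bin : ℕ → ℕ → ℕ
bin n       zero    = 1
bin zero    (suc k) = 0
bin (suc n) (suc k) = bin n k + bin n (suc k)

bin≡C : ∀ n k → n C k ≡ bin n k
bin≡C n       zero    = refl
bin≡C zero    (suc k) = refl
bin≡C (suc n) (suc k) =
  trans (sym (nCk+nC[k+1]≡[n+1]C[k+1] n k)) (cong₂ _+_ (bin≡C n k) (bin≡C n (suc k)))

-- Needed at level 0, where upper 0 j 1 = j must equal bin j 1.
bin-1 : ∀ n → bin n 1 ≡ n
bin-1 zero    = refl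
bin-1 (suc n) = cong suc (bin-1 n)

bin-mono : ∀ k {i j} → i ≤ j → bin i k ≤ bin j k
bin-mono k i≤j = go (≤⇒≤′ i≤j)
  where
  step : ∀ j k → bin j k ≤ bin (suc j) k
  step j zero    = ≤-refl
  step j (suc k) = m≤n+m (bin j (suc k)) (bin j k)
  go : ∀ {i j} → i ≤′ j → bin i k ≤ bin j k
  go ≤′-refl       = ≤-refl
  go (≤′-step i≤j) = ≤-trans (go i≤j) (step _ k)

bin-vanish : ∀ {n k} → n < k → bin n k ≡ 0
bin-vanish {zero}  {suc k} _         = refl
bin-vanish {suc n} {suc k} (s≤s n<k) = cong₂ _+_ (bin-vanish n<k) (bin-vanish (m<n⇒m<1+n n<k))

bin-pos : ∀ {n k} → k ≤ n → 1 ≤ bin n k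
bin-pos {n}     {zero}  _         = s≤s z≤n
bin-pos {suc n} {suc k} (s≤s k≤n) = ≤-trans (bin-pos k≤n) (m≤m+n _ _)

bin-support : ∀ n k → 1 ≤ bin n k → k ≤ n
bin-support n k pos with k ≤? n
... | yes k≤n = k≤n
... | no  k≰n with () ← ≤-trans pos (≤-reflexive (bin-vanish (≰⇒> k≰n)))

bin-pos-pred : ∀ n k → 1 ≤ bin n (suc k) → 1 ≤ bin n k
bin-pos-pred n k pos = bin-pos (≤-trans (n≤1+n k) (bin-support n (suc k) pos))

bin-pos-below : ∀ n k → 1 ≤ bin (suc n) (suc (suc k)) → 1 ≤ bin n (suc k)
bin-pos-below n k pos = bin-pos (≤-pred (bin-support (suc n) (suc (suc k)) pos))

-- upper k j x, for x ≤ bin j k, counts the (k+1)-subsets of {0,…,j-1} all of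
-- whose k-subsets are among the first x in colex order.  The colex list of
-- (k+1)-subsets of {0,…,j} is the list for {0,…,j-1} (bin j (k+1) sets)
-- followed by the sets containing j, whence the recursion.  On canonical
-- representations it is Σ binom(a_{k-i},k-i) ↦ Σ binom(a_{k-i},k+1-i)
-- (canonical-upper below).
upper : ℕ → ℕ → ℕ → ℕ
upper zero    j       zero    = 0
upper zero    j       (suc _) = j
upper (suc k) zero    x       = 0
upper (suc k) (suc j) x       =
  upper (suc k) j (x ⊓ bin j (suc k)) + upper k j (x ∸ bin j (suc k))

upper-zero : ∀ k j → upper k j 0 ≡ 0
upper-zero zero    j       = refl
upper-zero (suc k) zero    = refl
upper-zero (suc k) (suc j) =
  cong₂ _+_ (upper-zero (suc k) j) (trans (cong (upper k j) (0∸n≡0 (bin j (suc k)))) (upper-zero k j))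

upper-low : ∀ k j x → x ≤ bin j (suc k) → upper (suc k) (suc j) x ≡ upper (suc k) j x
upper-low k j x x≤a = begin
  upper (suc k) j (x ⊓ a) + upper k j (x ∸ a) ≡⟨ cong₂ _+_ (cong (upper (suc k) j) (m≤n⇒m⊓n≡m x≤a))
                                                          (cong (upper k j) (m≤n⇒m∸n≡0 x≤a)) ⟩
  upper (suc k) j x + upper k j 0               ≡⟨ cong (upper (suc k) j x +_) (upper-zero k j) ⟩
  upper (suc k) j x + 0                         ≡⟨ +-identityʳ _ ⟩
  upper (suc k) j x                             ∎
  where open ≡-Reasoning
        a = bin j (suc k)

upper-split : ∀ k j z →
  upper (suc k) (suc j) (bin j (suc k) + z) ≡ upper (suc k) j (bin j (suc k)) + upper k j z
upper-split k j z = cong₂ _+_ (cong (upper (suc k) j) (m≥n⇒m⊓n≡n (m≤m+n a z)))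
                              (cong (upper k j) (m+n∸m≡n a z))
  where a = bin j (suc k)

upper-full : ∀ k j → upper k j (bin j k) ≡ bin j (suc k)
upper-full zero    j       = sym (bin-1 j)
upper-full (suc k) zero    = refl
upper-full (suc k) (suc j) = begin
  upper (suc k) (suc j) (bin j k + bin j (suc k))          ≡⟨ cong (upper (suc k) (suc j)) (+-comm (bin j k) _) ⟩
  upper (suc k) (suc j) (bin j (suc k) + bin j k)          ≡⟨ upper-split k j (bin j k) ⟩
  upper (suc k) j (bin j (suc k)) + upper k j (bin j k)    ≡⟨ cong₂ _+_ (upper-full (suc k) j) (upper-full k j) ⟩
  bin j (suc (suc k)) + bin j (suc k)                      ≡⟨ +-comm (bin j (suc (suc k))) _ ⟩
  bin (suc j) (suc (suc k))                                ∎
  where open ≡-Reasoning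

upper-high : ∀ k j z →
  upper (suc k) (suc j) (bin j (suc k) + z) ≡ bin j (suc (suc k)) + upper k j z
upper-high k j z = trans (upper-split k j z) (cong (_+ upper k j z) (upper-full (suc k) j))

upper-stable : ∀ k {i j} → i ≤ j → ∀ y → y ≤ bin i (suc k) → upper (suc k) j y ≡ upper (suc k) i y
upper-stable k {i} i≤j y y≤ = go (≤⇒≤′ i≤j)
  where
  go : ∀ {j} → i ≤′ j → upper (suc k) j y ≡ upper (suc k) i y
  go ≤′-refl                 = refl
  go {suc j} (≤′-step i≤j) = trans (upper-low k j y (≤-trans y≤ (bin-mono (suc k) (≤′⇒≤ i≤j)))) (go i≤j)

-- A single k-set supports no (k+1)-set (stated for k = 1, where it is needed).
upper-one : ∀ j → upper 1 j 1 ≡ 0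
upper-one zero          = refl
upper-one (suc zero)    = refl
upper-one (suc (suc j)) = cong₂ _+_ (upper-one (suc j)) (cong (upper 0 (suc j)) (0∸n≡0 (bin j 1)))

data Split (a : ℕ) : ℕ → Set where
  below : ∀ {x} → x < a → Split a x
  above : ∀ z → Split a (a + z)

split : ∀ a x → Split a x
split a x with x <? a
... | yes x<a = below x<a
... | no  x≮a = subst (Split a) (m+[n∸m]≡n (≮⇒≥ x≮a)) (above (x ∸ a))

positive-gap : ∀ {m n} → m < n → ∃ λ d → 1 ≤ d × m + d ≡ n
positive-gap {m} m<n with m≤n⇒∃[o]m+o≡n m<n
... | d , m+1+d≡n = suc d , s≤s z≤n , trans (+-suc m d) m+1+d≡n

cut-inside : ∀ a c e d u → e + d ≡ c + a → d + u ≡ c → e ≡ a + u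
cut-inside a c e d u e+d≡c+a d+u≡c = +-cancelʳ-≡ d e (a + u) (begin
  e + d          ≡⟨ e+d≡c+a ⟩
  c + a          ≡⟨ cong (_+ a) (sym d+u≡c) ⟩
  (d + u) + a    ≡⟨ regroup d u a ⟩
  (a + u) + d    ∎)
  where
  open ≡-Reasoning
  regroup : ∀ d u a → (d + u) + a ≡ (a + u) + d
  regroup = solve-∀

Superadditive : ℕ → ℕ → Set
Superadditive k j = ∀ x y → x + y ≤ bin j k →
  upper k j x + upper k j y ≤ upper k j (x + y)

StrictOverflow : ℕ → ℕ → Set
StrictOverflow k j = ∀ x y s → x < bin j k → y < bin j k → x + y ≡ bin j k + s →
  upper k j x + upper k j y < bin j (suc k) + upper k j s

Overflow : ℕ → ℕ → Set
Overflow k j = ∀ x y s → x ≤ bin j k → y ≤ bin j k → x + y ≡ bin j k + s →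
  upper k j x + upper k j y ≤ bin j (suc k) + upper k j s

LevelDrop : ℕ → ℕ → Set
LevelDrop k j = ∀ x → x ≤ bin j (suc k) → x ≤ bin j k → upper (suc k) j x ≤ upper k j x

-- (T) Removing the last d ≥ 1 sets costs less at level k+1 than at level k:
-- binom(j,k+2) - upper (k+1) j e  <  binom(j,k+1) - upper k j e'.
TailGap : ℕ → ℕ → Set
TailGap k j = ∀ d e e' → 1 ≤ d → e + d ≡ bin j (suc k) → e' + d ≡ bin j k →
  bin j (suc (suc k)) + upper k j e' < bin j (suc k) + upper (suc k) j e

-- The strict overflow bound extends to the endpoints, where it is an equality.
overflow : ∀ k j → StrictOverflow k j → Overflow k j
overflow k j strict x y s x≤N y≤N x+y≡N+s with m≤n⇒m<n∨m≡n x≤N | m≤n⇒m<n∨m≡n y≤N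
... | inj₁ x<N | inj₁ y<N = <⇒≤ (strict x y s x<N y<N x+y≡N+s)
... | inj₂ refl | _ =
  ≤-reflexive (cong₂ _+_ (upper-full k j) (cong (upper k j) (+-cancelˡ-≡ (bin j k) y s x+y≡N+s)))
... | inj₁ _ | inj₂ refl =
  ≤-reflexive (trans (+-comm (upper k j x) _)
    (cong₂ _+_ (upper-full k j) (cong (upper k j) (+-cancelˡ-≡ (bin j k) x s (trans (+-comm (bin j k) x) x+y≡N+s)))))

-- Splitting x at the first colex block, the
-- block is handled by induction on i, the rest by stability, and the two
-- are recombined by superadditivity on J.
level-drop-across : ∀ k J → Superadditive (suc k) J → ∀ i → i ≤ J →
  ∀ x → x ≤ bin i (suc (suc k)) → x ≤ bin J (suc k) →
  upper (suc (suc k)) i x ≤ upper (suc k) J x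
level-drop-across k J super zero    _   x _ _ = z≤n
level-drop-across k J super (suc i) i<J x x≤ x≤J with split (bin i (suc (suc k))) x
... | below x<a = begin
  upper (suc (suc k)) (suc i) x ≡⟨ upper-low (suc k) i x (<⇒≤ x<a) ⟩
  upper (suc (suc k)) i x       ≤⟨ level-drop-across k J super i (<⇒≤ i<J) x (<⇒≤ x<a) x≤J ⟩
  upper (suc k) J x             ∎
  where open ≤-Reasoning
... | above z = begin
  upper (suc (suc k)) (suc i) (a + z)   ≡⟨ upper-split (suc k) i z ⟩
  upper (suc (suc k)) i a + H i z       ≤⟨ +-monoˡ-≤ (H i z) (level-drop-across k J super i i≤J a ≤-refl a≤) ⟩
  H J a + H i z                         ≡⟨ cong (H J a +_) (sym (upper-stable k i≤J z z≤)) ⟩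
  H J a + H J z                         ≤⟨ super a z x≤J ⟩
  H J (a + z)                           ∎
  where
  open ≤-Reasoning
  a = bin i (suc (suc k))
  H = upper (suc k)
  i≤J : i ≤ J
  i≤J = <⇒≤ i<J
  a≤ : a ≤ bin J (suc k)
  a≤ = ≤-trans (m≤m+n a z) x≤J
  z≤ : z ≤ bin i (suc k)
  z≤ = +-cancelˡ-≤ a z _ (subst (a + z ≤_) (+-comm (bin i (suc k)) a) x≤)

-- At level 0 the argument is 0 or 1, and upper 1 j vanishes on both.
level-drop : ∀ k j → Superadditive k j → LevelDrop k j
level-drop zero    j _     zero             _ _        = ≤-reflexive (upper-zero 1 j)
level-drop zero    j _     (suc zero)       _ _        = ≤-trans (≤-reflexive (upper-one j)) z≤n
level-drop zero    j _     (suc (suc x))    _ (s≤s ())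
level-drop (suc k) j super x x≤ x≤J = level-drop-across k j super j ≤-refl x x≤ x≤J

-- Base cases at level 0: the arguments are 0 or 1 (bin j 0 = 1), and
-- upper 0 j 1 = j.
superadditive-0 : ∀ j → Superadditive 0 j
superadditive-0 j zero    y       _ = ≤-refl
superadditive-0 j (suc x) zero    _ = ≤-reflexive (+-identityʳ j)
superadditive-0 j (suc x) (suc y) (s≤s x+y<1) with () ← m+n≤o⇒n≤o x x+y<1

strict-overflow-0 : ∀ j → StrictOverflow 0 j
strict-overflow-0 j zero    zero    s _ _ ()
strict-overflow-0 j (suc x) y       s (s≤s ()) _
strict-overflow-0 j zero    (suc y) s _ (s≤s ())

-- The only instance is d = 1, e' = 0, j = e + 1, where the right-hand side
-- is computed by upper-full.
tail-gap-0 : ∀ j → TailGap 0 j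
tail-gap-0 j       (suc zero)    e zero     _ e+1≡j refl = gap j e+1≡j
  where
  gap : ∀ n → e + 1 ≡ bin n 1 → bin n 2 + 0 < bin n 1 + upper 1 n e
  gap zero    e+1≡0 with () ← m+n≡0⇒n≡0 e e+1≡0
  gap (suc i) e+1≡j = begin-strict
    bin i 1 + bin i 2 + 0         ≡⟨ +-identityʳ _ ⟩
    bin i 1 + bin i 2             <⟨ n<1+n _ ⟩
    suc (bin i 1) + bin i 2       ≡⟨ cong (suc (bin i 1) +_) (sym upper-e) ⟩
    suc (bin i 1) + upper 1 (suc i) e ∎
    where
    open ≤-Reasoning
    e≡ : e ≡ bin i 1
    e≡ = suc-injective (trans (+-comm 1 e) e+1≡j)
    upper-e : upper 1 (suc i) e ≡ bin i 2
    upper-e = trans (upper-low 0 i e (≤-reflexive e≡)) (trans (cong (upper 1 i) e≡) (upper-full 1 i))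
tail-gap-0 j       (suc zero)    e (suc e') _ _ e'+2≡1 with () ← m+n≡0⇒n≡0 e' (suc-injective e'+2≡1)
tail-gap-0 j       (suc (suc d)) e e'       _ _ e'+d≡1
  with () ← m+n≡0⇒n≡0 e' (suc-injective (trans (sym (+-suc e' (suc d))) e'+d≡1))

record Invariant (j : ℕ) : Set where
  field
    superadditive  : ∀ k → Superadditive k j
    strictOverflow : ∀ k → StrictOverflow k j
    tailGap        : ∀ k → TailGap k j

-- Induction base: on the empty ground set all positive levels are empty.
invariant-0 : Invariant 0
invariant-0 = record { superadditive = super ; strictOverflow = strict ; tailGap = tail }
  where
  super : ∀ k → Superadditive k 0
  super zero    = superadditive-0 0
  super (suc k) _ _ _ = z≤n
  strict : ∀ k → StrictOverflow k 0
  strict zero    = strict-overflow-0 0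
  strict (suc k) _ _ _ ()
  tail : ∀ k → TailGap k 0
  tail zero = tail-gap-0 0
  tail (suc k) (suc d) e _ _ e+d≡0 _ with () ← m+n≡0⇒n≡0 e e+d≡0

-- At level
-- k + 1 the colex list on {0,…,j} is the block of length a = binom(j,k+1) on
-- {0,…,j-1} (where upper (k+1) (j+1) = upper (k+1) j) followed by a block of
-- length binom(j,k) (where upper (k+1) (j+1) (a + z) = binom(j,k+2) + upper k j z).
module Step (j : ℕ) (inv : Invariant j) where
  open Invariant inv

  overflowⱼ : ∀ k → Overflow k j
  overflowⱼ k = overflow k j (strictOverflow k)

  dropⱼ : ∀ k → LevelDrop k j
  dropⱼ k = level-drop k j (superadditive k)

  full-drop : ∀ k → bin j (suc k) ≤ bin j k → bin j (suc (suc k)) ≤ upper k j (bin j (suc k))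
  full-drop k a≤b = subst (_≤ upper k j (bin j (suc k))) (upper-full (suc k) j) (dropⱼ k _ ≤-refl a≤b)

  superadditive-above : ∀ k x' y → bin j (suc k) + x' + y ≤ bin (suc j) (suc k) →
    upper (suc k) (suc j) (bin j (suc k) + x') + upper (suc k) (suc j) y
      ≤ upper (suc k) (suc j) (bin j (suc k) + x' + y)
  superadditive-above k x' y bound = begin
    G' (a + x') + G' y   ≡⟨ cong (_+ G' y) (upper-high k j x') ⟩
    A + G x' + G' y      ≡⟨ +-assoc A _ _ ⟩
    A + (G x' + G' y)    ≤⟨ +-monoʳ-≤ A (absorb y x'+y≤b) ⟩
    A + G (x' + y)       ≡⟨ sym (upper-high k j (x' + y)) ⟩
    G' (a + (x' + y))    ≡⟨ cong G' (sym (+-assoc a x' y)) ⟩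
    G' (a + x' + y)      ∎
    where
    open ≤-Reasoning
    a = bin j (suc k)
    b = bin j k
    A = bin j (suc (suc k))
    G = upper k j
    G' = upper (suc k) (suc j)
    x'+y≤b : x' + y ≤ b
    x'+y≤b = +-cancelˡ-≤ a _ _ (subst₂ _≤_ (+-assoc a x' y) (+-comm b a) bound)
    absorb : ∀ w → x' + w ≤ b → G x' + G' w ≤ G (x' + w)
    absorb w x'+w≤b with split a w
    ... | below w<a = begin
      G x' + G' w               ≡⟨ cong (G x' +_) (upper-low k j w (<⇒≤ w<a)) ⟩
      G x' + upper (suc k) j w  ≤⟨ +-monoʳ-≤ (G x') (dropⱼ k w (<⇒≤ w<a) (m+n≤o⇒n≤o x' x'+w≤b)) ⟩
      G x' + G w                ≤⟨ superadditive k x' w x'+w≤b ⟩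
      G (x' + w)                ∎
    ... | above y' = begin
      G x' + G' (a + y')        ≡⟨ cong (G x' +_) (upper-high k j y') ⟩
      G x' + (A + G y')         ≤⟨ +-monoʳ-≤ (G x') (+-monoˡ-≤ (G y') (full-drop k (m+n≤o⇒m≤o a a+y'≤b))) ⟩
      G x' + (G a + G y')       ≤⟨ +-monoʳ-≤ (G x') (superadditive k a y' a+y'≤b) ⟩
      G x' + G (a + y')         ≤⟨ superadditive k x' (a + y') x'+w≤b ⟩
      G (x' + (a + y'))         ∎
      where
      a+y'≤b : a + y' ≤ b
      a+y'≤b = m+n≤o⇒n≤o x' x'+w≤b

  -- (P) when both summands lie in the first block: if their sum overflows it,
  -- (O) at level k+1 and (D) bound the two parts.
  superadditive-below : ∀ k x y → x < bin j (suc k) → y < bin j (suc k) → x + y ≤ bin (suc j) (suc k) →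
    upper (suc k) (suc j) x + upper (suc k) (suc j) y ≤ upper (suc k) (suc j) (x + y)
  superadditive-below k x y x<a y<a bound with x + y ≤? bin j (suc k)
  ... | yes x+y≤a = begin
    G' x + G' y     ≡⟨ cong₂ _+_ (upper-low k j x (<⇒≤ x<a)) (upper-low k j y (<⇒≤ y<a)) ⟩
    H x + H y       ≤⟨ superadditive (suc k) x y x+y≤a ⟩
    H (x + y)       ≡⟨ sym (upper-low k j (x + y) x+y≤a) ⟩
    G' (x + y)      ∎
    where
    open ≤-Reasoning
    H = upper (suc k) j
    G' = upper (suc k) (suc j)
  ... | no x+y≰a with m≤n⇒∃[o]m+o≡n (<⇒≤ (≰⇒> x+y≰a))
  ...   | z , a+z≡x+y = begin
    G' x + G' y     ≡⟨ cong₂ _+_ (upper-low k j x (<⇒≤ x<a)) (upper-low k j y (<⇒≤ y<a)) ⟩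
    H x + H y       ≤⟨ overflowⱼ (suc k) x y z (<⇒≤ x<a) (<⇒≤ y<a) (sym a+z≡x+y) ⟩
    A + H z         ≤⟨ +-monoʳ-≤ A (dropⱼ k z z≤a z≤b) ⟩
    A + upper k j z ≡⟨ sym (upper-high k j z) ⟩
    G' (a + z)      ≡⟨ cong G' a+z≡x+y ⟩
    G' (x + y)      ∎
    where
    open ≤-Reasoning
    a = bin j (suc k)
    A = bin j (suc (suc k))
    H = upper (suc k) j
    G' = upper (suc k) (suc j)
    z≤a : z ≤ a
    z≤a = ≤-trans (+-cancelˡ-≤ a z y (subst (_≤ a + y) (sym a+z≡x+y) (+-monoˡ-≤ y (<⇒≤ x<a)))) (<⇒≤ y<a)
    z≤b : z ≤ bin j k
    z≤b = +-cancelˡ-≤ a z _ (subst₂ _≤_ (sym a+z≡x+y) (+-comm (bin j k) a) bound)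

  superadditive-step : ∀ k → Superadditive k (suc j)
  superadditive-step zero = superadditive-0 (suc j)
  superadditive-step (suc k) x y bound with split (bin j (suc k)) x | split (bin j (suc k)) y
  ... | above x' | _         = superadditive-above k x' y bound
  ... | below _  | above y'  =
    subst₂ _≤_ (+-comm (G' (bin j (suc k) + y')) (G' x)) (cong G' (+-comm (bin j (suc k) + y') x))
      (superadditive-above k y' x (subst (_≤ bin (suc j) (suc k)) (+-comm x _) bound))
    where G' = upper (suc k) (suc j)
  ... | below x<a | below y<a = superadditive-below k x y x<a y<a bound

  -- (O) at level k+1, both parts in the second block, and so is the excess:
  -- (O) at level k on the offsets.
  overflow-high-high-wrap : ∀ k x' y' t → x' < bin j k → y' < bin j k → x' + y' ≡ bin j k + t →
    upper (suc k) (suc j) (bin j (suc k) + x') + upper (suc k) (suc j) (bin j (suc k) + y')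
      < bin (suc j) (suc (suc k)) + upper (suc k) (suc j) (bin j (suc k) + t)
  overflow-high-high-wrap k x' y' t x'<b y'<b x'+y'≡b+t = begin-strict
    G' (a + x') + G' (a + y')   ≡⟨ cong₂ _+_ (upper-high k j x') (upper-high k j y') ⟩
    (A + G x') + (A + G y')     ≡⟨ interchange A (G x') A (G y') ⟩
    (A + A) + (G x' + G y')     <⟨ +-monoʳ-< (A + A) (strictOverflow k x' y' t x'<b y'<b x'+y'≡b+t) ⟩
    (A + A) + (a + G t)         ≡⟨ regroup A a (G t) ⟩
    (a + A) + (A + G t)         ≡⟨ cong ((a + A) +_) (sym (upper-high k j t)) ⟩
    (a + A) + G' (a + t)        ∎
    where
    open ≤-Reasoning
    a = bin j (suc k)
    A = bin j (suc (suc k))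
    G = upper k j
    G' = upper (suc k) (suc j)
    regroup : ∀ A a g → (A + A) + (a + g) ≡ (a + A) + (A + g)
    regroup = solve-∀

  -- (O) at level k+1, both parts in the second block, excess s in the first:
  -- (P) and (T) at level k.
  overflow-high-high-short : ∀ k x' y' s d → 1 ≤ d → (x' + y') + d ≡ bin j k → s + d ≡ bin j (suc k) →
    upper (suc k) (suc j) (bin j (suc k) + x') + upper (suc k) (suc j) (bin j (suc k) + y')
      < bin (suc j) (suc (suc k)) + upper (suc k) (suc j) s
  overflow-high-high-short k x' y' s d 1≤d x'+y'+d≡b s+d≡a = begin-strict
    G' (a + x') + G' (a + y')   ≡⟨ cong₂ _+_ (upper-high k j x') (upper-high k j y') ⟩
    (A + G x') + (A + G y')     ≡⟨ interchange A (G x') A (G y') ⟩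
    (A + A) + (G x' + G y')     ≤⟨ +-monoʳ-≤ (A + A) (superadditive k x' y' (m+n≤o⇒m≤o (x' + y') b-bound)) ⟩
    (A + A) + G (x' + y')       ≡⟨ +-assoc A A _ ⟩
    A + (A + G (x' + y'))       <⟨ +-monoʳ-< A (tailGap k d s (x' + y') 1≤d s+d≡a x'+y'+d≡b) ⟩
    A + (a + H s)               ≡⟨ sym (+-assoc A a _) ⟩
    (A + a) + H s               ≡⟨ cong₂ _+_ (+-comm A a) (sym (upper-low k j s (m+n≤o⇒m≤o s a-bound))) ⟩
    (a + A) + G' s              ∎
    where
    open ≤-Reasoning
    a = bin j (suc k)
    A = bin j (suc (suc k))
    G = upper k j
    H = upper (suc k) j
    G' = upper (suc k) (suc j)
    b-bound = ≤-reflexive x'+y'+d≡b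
    a-bound = ≤-reflexive s+d≡a

  -- Writing y = L + s with
  -- x' + L = b, the gap L is charged to (T) at level k, the rest to (O) at
  -- level k+1 for y and the complement e of L in the first block.
  overflow-high-low : ∀ k x' y s → x' < bin j k → y < bin j (suc k) → x' + y ≡ bin j k + s →
    upper (suc k) (suc j) (bin j (suc k) + x') + upper (suc k) (suc j) y
      < bin (suc j) (suc (suc k)) + upper (suc k) (suc j) s
  overflow-high-low k x' y s x'<b y<a x'+y≡b+s with positive-gap x'<b
  ... | L , 1≤L , x'+L≡b = begin-strict
    G' (a + x') + G' y    ≡⟨ cong₂ _+_ (upper-high k j x') (upper-low k j y (<⇒≤ y<a)) ⟩
    (A + G x') + H y      <⟨ +-monoˡ-< (H y) (tailGap k L e x' 1≤L (trans (+-comm e L) L+e≡a) x'+L≡b) ⟩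
    (a + H e) + H y       ≡⟨ xy∙z≈x∙zy a (H e) (H y) ⟩
    a + (H y + H e)       ≤⟨ +-monoʳ-≤ a (overflowⱼ (suc k) y e s (<⇒≤ y<a) e≤a y+e≡a+s) ⟩
    a + (A + H s)         ≡⟨ sym (+-assoc a A _) ⟩
    (a + A) + H s         ≡⟨ cong ((a + A) +_) (sym (upper-low k j s s≤a)) ⟩
    (a + A) + G' s        ∎
    where
    open ≤-Reasoning
    a = bin j (suc k)
    A = bin j (suc (suc k))
    G = upper k j
    H = upper (suc k) j
    G' = upper (suc k) (suc j)
    y≡L+s : y ≡ L + s
    y≡L+s = +-cancelˡ-≡ x' y (L + s) (trans x'+y≡b+s (trans (cong (_+ s) (sym x'+L≡b)) (+-assoc x' L s)))
    s≤a : s ≤ a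
    s≤a = ≤-trans (subst (s ≤_) (sym y≡L+s) (m≤n+m s L)) (<⇒≤ y<a)
    L≤a : L ≤ a
    L≤a = ≤-trans (subst (L ≤_) (sym y≡L+s) (m≤m+n L s)) (<⇒≤ y<a)
    e = proj₁ (m≤n⇒∃[o]m+o≡n L≤a)
    L+e≡a : L + e ≡ a
    L+e≡a = proj₂ (m≤n⇒∃[o]m+o≡n L≤a)
    e≤a : e ≤ a
    e≤a = m+n≤o⇒n≤o L (≤-reflexive L+e≡a)
    y+e≡a+s : y + e ≡ a + s
    y+e≡a+s = trans (cong (_+ e) y≡L+s) (trans (xy∙z≈xz∙y L s e) (cong (_+ s) L+e≡a))

  tail-gap-whole : ∀ k e → 1 ≤ bin j k → e + bin j k ≡ bin j (suc k) →
    bin j (suc (suc k)) < bin j (suc k) + upper (suc k) j e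
  tail-gap-whole k e 1≤b e+b≡a =
    subst (_< bin j (suc k) + upper (suc k) j e) (trans (cong (bin j (suc (suc k)) +_) (upper-zero k j)) (+-identityʳ _))
      (tailGap k (bin j k) e 0 1≤b e+b≡a refl)

  -- (O) at level k+1, both parts in the first block, so the excess b + s
  -- still lies there.  (O) at level k+1 twice, on (x, y) and on (b + s, e)
  -- with b + e = a, and (T) at level k for the gap b.
  overflow-low-low : ∀ k x y s → x < bin j (suc k) → y < bin j (suc k) → x + y ≡ bin (suc j) (suc k) + s →
    upper (suc k) (suc j) x + upper (suc k) (suc j) y < bin (suc j) (suc (suc k)) + upper (suc k) (suc j) s
  overflow-low-low k x y s x<a y<a x+y≡ = +-cancelʳ-< (H e) _ _ (begin-strict
    (G' x + G' y) + H e      ≡⟨ cong (_+ H e) (cong₂ _+_ (upper-low k j x x≤a) (upper-low k j y y≤a)) ⟩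
    (H x + H y) + H e        ≤⟨ +-monoˡ-≤ (H e) (overflowⱼ (suc k) x y (b + s) x≤a y≤a x+y≡a+b+s) ⟩
    (A + H (b + s)) + H e    ≡⟨ +-assoc A _ _ ⟩
    A + (H (b + s) + H e)    ≤⟨ +-monoʳ-≤ A (overflowⱼ (suc k) (b + s) e s b+s≤a e≤a b+s+e≡a+s) ⟩
    A + (A + H s)            <⟨ +-monoˡ-< (A + H s) A<a+He ⟩
    (a + H e) + (A + H s)    ≡⟨ regroup a (H e) A (H s) ⟩
    ((a + A) + H s) + H e    ≡⟨ cong (λ v → ((a + A) + v) + H e) (sym (upper-low k j s (m+n≤o⇒n≤o b b+s≤a))) ⟩
    ((a + A) + G' s) + H e   ∎)
    where
    open ≤-Reasoning
    a = bin j (suc k)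
    b = bin j k
    A = bin j (suc (suc k))
    H = upper (suc k) j
    G' = upper (suc k) (suc j)
    x≤a = <⇒≤ x<a
    y≤a = <⇒≤ y<a
    x+y≡a+b+s : x + y ≡ a + (b + s)
    x+y≡a+b+s = trans x+y≡ (xy∙z≈y∙xz b a s)
    b+s≤a : b + s ≤ a
    b+s≤a = ≤-trans (<⇒≤ (+-cancelˡ-< a (b + s) y (subst (_< a + y) x+y≡a+b+s (+-monoˡ-< y x<a)))) (<⇒≤ y<a)
    e = proj₁ (m≤n⇒∃[o]m+o≡n (m+n≤o⇒m≤o b b+s≤a))
    b+e≡a : b + e ≡ a
    b+e≡a = proj₂ (m≤n⇒∃[o]m+o≡n (m+n≤o⇒m≤o b b+s≤a))
    e≤a : e ≤ a
    e≤a = m+n≤o⇒n≤o b (≤-reflexive b+e≡a)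
    b+s+e≡a+s : b + s + e ≡ a + s
    b+s+e≡a+s = trans (xy∙z≈xz∙y b s e) (cong (_+ s) b+e≡a)
    A<a+He : A < a + H e
    A<a+He = tail-gap-whole k e (bin-pos-pred j k (≤-trans (s≤s z≤n) x<a)) (trans (+-comm e b) b+e≡a)
    regroup : ∀ a h A g → (a + h) + (A + g) ≡ ((a + A) + g) + h
    regroup = solve-∀

  overflow-high-high : ∀ k x' y' s → x' < bin j k → y' < bin j k →
    (bin j (suc k) + x') + (bin j (suc k) + y') ≡ bin (suc j) (suc k) + s →
    upper (suc k) (suc j) (bin j (suc k) + x') + upper (suc k) (suc j) (bin j (suc k) + y')
      < bin (suc j) (suc (suc k)) + upper (suc k) (suc j) s
  overflow-high-high k x' y' s x'<b y'<b x+y≡ with x' + y' <? bin j k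
  ... | yes x'+y'<b with positive-gap x'+y'<b
  ...   | d , 1≤d , x'+y'+d≡b = overflow-high-high-short k x' y' s d 1≤d x'+y'+d≡b s+d≡a
    where
    a = bin j (suc k)
    p = x' + y'
    s+d≡a : s + d ≡ a
    s+d≡a = sym (+-cancelˡ-≡ a _ _ (+-cancelˡ-≡ p _ _ (begin
      p + (a + a)             ≡⟨ +-comm p (a + a) ⟩
      (a + a) + p             ≡⟨ sym (interchange a x' a y') ⟩
      (a + x') + (a + y')     ≡⟨ x+y≡ ⟩
      (bin j k + a) + s       ≡⟨ cong (λ b → (b + a) + s) (sym x'+y'+d≡b) ⟩
      ((p + d) + a) + s       ≡⟨ regroup p d a s ⟩
      p + (a + (s + d))       ∎)))
      where
      open ≡-Reasoning
      regroup : ∀ p d a s → ((p + d) + a) + s ≡ p + (a + (s + d))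
      regroup = solve-∀
  overflow-high-high k x' y' s x'<b y'<b x+y≡ | no x'+y'≮b with m≤n⇒∃[o]m+o≡n (≮⇒≥ x'+y'≮b)
  ...   | t , b+t≡x'+y' = subst (λ s → _ < bin (suc j) (suc (suc k)) + upper (suc k) (suc j) s) (sym s≡a+t)
    (overflow-high-high-wrap k x' y' t x'<b y'<b (sym b+t≡x'+y'))
    where
    a = bin j (suc k)
    b = bin j k
    s≡a+t : s ≡ a + t
    s≡a+t = +-cancelˡ-≡ (b + a) _ _ (begin
      (b + a) + s             ≡⟨ sym x+y≡ ⟩
      (a + x') + (a + y')     ≡⟨ interchange a x' a y' ⟩
      (a + a) + (x' + y')     ≡⟨ cong ((a + a) +_) (sym b+t≡x'+y') ⟩
      (a + a) + (b + t)       ≡⟨ regroup a b t ⟩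
      (b + a) + (a + t)       ∎)
      where
      open ≡-Reasoning
      regroup : ∀ a b t → (a + a) + (b + t) ≡ (b + a) + (a + t)
      regroup = solve-∀

  offset< : ∀ k {x'} → bin j (suc k) + x' < bin (suc j) (suc k) → x' < bin j k
  offset< k {x'} h = +-cancelˡ-< (bin j (suc k)) x' _ (subst (bin j (suc k) + x' <_) (+-comm (bin j k) _) h)

  drop-block : ∀ k {x' y s} → (bin j (suc k) + x') + y ≡ bin (suc j) (suc k) + s → x' + y ≡ bin j k + s
  drop-block k {x'} {y} {s} h =
    +-cancelˡ-≡ (bin j (suc k)) _ _ (trans (sym (+-assoc _ x' y)) (trans h (xy∙z≈y∙xz (bin j k) _ s)))

  strict-overflow-step : ∀ k → StrictOverflow k (suc j)
  strict-overflow-step zero = strict-overflow-0 (suc j)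
  strict-overflow-step (suc k) x y s x<N y<N x+y≡ with split (bin j (suc k)) x | split (bin j (suc k)) y
  ... | above x' | above y'  = overflow-high-high k x' y' s (offset< k x<N) (offset< k y<N) x+y≡
  ... | above x' | below y<a = overflow-high-low k x' y s (offset< k x<N) y<a (drop-block k x+y≡)
  ... | below x<a | above y' =
    subst (_< bin (suc j) (suc (suc k)) + upper (suc k) (suc j) s) (+-comm (upper (suc k) (suc j) (bin j (suc k) + y')) _)
      (overflow-high-low k y' x s (offset< k y<N) x<a (drop-block k (trans (+-comm (bin j (suc k) + y') x) x+y≡)))
  ... | below x<a | below y<a = overflow-low-low k x y s x<a y<a x+y≡

  TailGapFor : ℕ → ℕ → Set
  TailGapFor k d = ∀ e e' → 1 ≤ d → e + d ≡ bin (suc j) (suc k) → e' + d ≡ bin (suc j) k →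
    bin (suc j) (suc (suc k)) + upper k (suc j) e' < bin (suc j) (suc k) + upper (suc k) (suc j) e

  -- In the cases below, at level k+2 the list is A = binom(j,k+2) followed by
  -- a = binom(j,k+1), at level k+1 it is a followed by b = binom(j,k); each
  -- case says whether the tail d stays inside the second block at each level.

  -- Inside at both levels: (T) at level k on {0,…,j-1}.
  tail-gap-inside-inside : ∀ k d → d ≤ bin j (suc k) → d ≤ bin j k → TailGapFor (suc k) d
  tail-gap-inside-inside k d d≤a d≤b e e' 1≤d e+d≡ e'+d≡
    with m≤n⇒∃[o]m+o≡n d≤a | m≤n⇒∃[o]m+o≡n d≤b
  ... | u , d+u≡a | f , d+f≡b with cut-inside (bin j (suc (suc k))) (bin j (suc k)) e d u e+d≡ d+u≡a
       | cut-inside (bin j (suc k)) (bin j k) e' d f e'+d≡ d+f≡b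
  ... | refl | refl = begin-strict
    (A + T) + G' (a + f)     ≡⟨ cong ((A + T) +_) (upper-high k j f) ⟩
    (A + T) + (A + G f)      <⟨ +-monoʳ-< (A + T) (tailGap k d u f 1≤d u+d≡a f+d≡b) ⟩
    (A + T) + (a + H u)      ≡⟨ regroup A T a (H u) ⟩
    (a + A) + (T + H u)      ≡⟨ cong ((a + A) +_) (sym (upper-high (suc k) j u)) ⟩
    (a + A) + K' (A + u)     ∎
    where
    open ≤-Reasoning
    a = bin j (suc k)
    A = bin j (suc (suc k))
    T = bin j (suc (suc (suc k)))
    G = upper k j
    H = upper (suc k) j
    G' = upper (suc k) (suc j)
    K' = upper (suc (suc k)) (suc j)
    u+d≡a : u + d ≡ a
    u+d≡a = trans (+-comm u d) d+u≡a
    f+d≡b : f + d ≡ bin j k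
    f+d≡b = trans (+-comm f d) d+f≡b
    regroup : ∀ A T a h → (A + T) + (a + h) ≡ (a + A) + (T + h)
    regroup = solve-∀

  -- Inside at level k+2, across at level k+1: with b + w = a, (O) at level
  -- k+1 on {0,…,j-1} for (e', w) and (T) for removing the whole block b.
  tail-gap-inside-across : ∀ k d → d ≤ bin j (suc k) → bin j k < d → TailGapFor (suc k) d
  tail-gap-inside-across k d d≤a b<d e e' 1≤d e+d≡ e'+d≡ with m≤n⇒∃[o]m+o≡n d≤a
  ... | u , d+u≡a with cut-inside (bin j (suc (suc k))) (bin j (suc k)) e d u e+d≡ d+u≡a
                      | cut-inside (bin j k) (bin j (suc k)) e' d u (trans e'+d≡ (+-comm (bin j k) _)) d+u≡a
  ... | refl | refl = +-cancelʳ-< (H w) _ _ (begin-strict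
    ((A + T) + G' (b + u)) + H w  ≡⟨ cong (λ v → ((A + T) + v) + H w) (upper-low k j (b + u) b+u≤a) ⟩
    ((A + T) + H (b + u)) + H w   ≡⟨ +-assoc (A + T) _ _ ⟩
    (A + T) + (H (b + u) + H w)   ≤⟨ +-monoʳ-≤ (A + T) (overflowⱼ (suc k) (b + u) w u b+u≤a w≤a b+u+w≡a+u) ⟩
    (A + T) + (A + H u)           ≡⟨ +-assoc A T _ ⟩
    A + (T + (A + H u))           <⟨ +-monoˡ-< (T + (A + H u)) (tail-gap-whole k w 1≤b (trans (+-comm w b) b+w≡a)) ⟩
    (a + H w) + (T + (A + H u))   ≡⟨ regroup a (H w) T A (H u) ⟩
    ((a + A) + (T + H u)) + H w   ≡⟨ cong (λ v → ((a + A) + v) + H w) (sym (upper-high (suc k) j u)) ⟩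
    ((a + A) + K' (A + u)) + H w  ∎)
    where
    open ≤-Reasoning
    b = bin j k
    a = bin j (suc k)
    A = bin j (suc (suc k))
    T = bin j (suc (suc (suc k)))
    H = upper (suc k) j
    G' = upper (suc k) (suc j)
    K' = upper (suc (suc k)) (suc j)
    b+u≤a : b + u ≤ a
    b+u≤a = <⇒≤ (subst (b + u <_) d+u≡a (+-monoˡ-< u b<d))
    1≤b : 1 ≤ b
    1≤b = bin-pos-pred j k (≤-trans 1≤d d≤a)
    b≤a : b ≤ a
    b≤a = ≤-trans (<⇒≤ b<d) d≤a
    w = proj₁ (m≤n⇒∃[o]m+o≡n b≤a)
    b+w≡a : b + w ≡ a
    b+w≡a = proj₂ (m≤n⇒∃[o]m+o≡n b≤a)
    w≤a : w ≤ a
    w≤a = m+n≤o⇒n≤o b (≤-reflexive b+w≡a)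
    b+u+w≡a+u : (b + u) + w ≡ a + u
    b+u+w≡a+u = trans (xy∙z≈xz∙y b u w) (cong (_+ u) b+w≡a)
    regroup : ∀ a h T A u → (a + h) + (T + (A + u)) ≡ ((a + A) + (T + u)) + h
    regroup = solve-∀

  overflowⱼ₊₁ : ∀ k → Overflow k (suc j)
  overflowⱼ₊₁ k = overflow k (suc j) (strict-overflow-step k)

  -- Appending the whole last block a at level k+2 to an argument e of the
  -- first block raises upper (k+2) on {0,…,j} by at most binom(j,k+2):
  -- (O) at level k+2 for the pair (e + a, A).
  overhang : ∀ k e → e ≤ bin j (suc (suc k)) →
    upper (suc (suc k)) (suc j) (e + bin j (suc k)) ≤ bin j (suc (suc k)) + upper (suc (suc k)) (suc j) e
  overhang k e e≤A = +-cancelʳ-≤ T _ _ (begin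
    K' (e + a) + T          ≡⟨ cong (K' (e + a) +_) (sym K'A≡T) ⟩
    K' (e + a) + K' A       ≤⟨ overflowⱼ₊₁ (suc (suc k)) (e + a) A e e+a≤a+A A≤a+A sum≡ ⟩
    (A + T) + K' e          ≡⟨ xy∙z≈xz∙y A T (K' e) ⟩
    (A + K' e) + T          ∎)
    where
    open ≤-Reasoning
    a = bin j (suc k)
    A = bin j (suc (suc k))
    T = bin j (suc (suc (suc k)))
    K' = upper (suc (suc k)) (suc j)
    K'A≡T : K' A ≡ T
    K'A≡T = trans (upper-low (suc k) j A ≤-refl) (upper-full (suc (suc k)) j)
    e+a≤a+A : e + a ≤ a + A
    e+a≤a+A = subst (_≤ a + A) (+-comm a e) (+-monoʳ-≤ a e≤A)
    A≤a+A : A ≤ a + A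
    A≤a+A = m≤n+m A a
    sum≡ : (e + a) + A ≡ (a + A) + e
    sum≡ = xy∙z≈yz∙x e a A

  -- Across at level k+2 (a < d = a + t), inside at level k+1 (e' = a + f):
  -- the shorter tail t is handled by induction, the overhang a by `overhang`,
  -- and the block A at level k+1 is absorbed by (P), (D) at level k.
  tail-gap-across-inside : ∀ k d → bin j (suc k) < d → d ≤ bin j k →
    (∀ {d'} → d' < d → TailGapFor (suc k) d') → TailGapFor (suc k) d
  tail-gap-across-inside k d a<d d≤b ih e e' 1≤d e+d≡ e'+d≡ with positive-gap a<d | m≤n⇒∃[o]m+o≡n d≤b
  ... | t , 1≤t , a+t≡d | f , d+f≡b with cut-inside (bin j (suc k)) (bin j k) e' d f e'+d≡ d+f≡b
  ... | refl = +-cancelʳ-< A _ _ (begin-strict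
    ((A + T) + G' (a + f)) + A   ≡⟨ cong (λ v → ((A + T) + v) + A) (upper-high k j f) ⟩
    ((A + T) + (A + G f)) + A    ≡⟨ +-assoc (A + T) _ _ ⟩
    (A + T) + ((A + G f) + A)    ≡⟨ cong ((A + T) +_) (+-comm _ A) ⟩
    (A + T) + (A + (A + G f))    ≤⟨ +-monoʳ-≤ (A + T) (+-monoʳ-≤ A absorb) ⟩
    (A + T) + (A + G g)          ≡⟨ cong ((A + T) +_) (sym (upper-high k j g)) ⟩
    (A + T) + G' (a + g)         <⟨ ih t<d (e + a) (a + g) 1≤t e+a+t≡a+A a+g+t≡b+a ⟩
    (a + A) + K' (e + a)         ≤⟨ +-monoʳ-≤ (a + A) (overhang k e (m+n≤o⇒m≤o e (≤-reflexive e+t≡A))) ⟩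
    (a + A) + (A + K' e)         ≡⟨ x∙yz≈xz∙y (a + A) A (K' e) ⟩
    ((a + A) + K' e) + A         ∎)
    where
    open ≤-Reasoning
    b = bin j k
    a = bin j (suc k)
    A = bin j (suc (suc k))
    T = bin j (suc (suc (suc k)))
    G = upper k j
    G' = upper (suc k) (suc j)
    K' = upper (suc (suc k)) (suc j)
    g = f + a
    e+t≡A : e + t ≡ A
    e+t≡A = +-cancelˡ-≡ a _ _ (trans (sym (x∙yz≈y∙xz e a t)) (trans (cong (e +_) a+t≡d) e+d≡))
    t<d : t < d
    t<d = subst (t <_) a+t≡d (+-monoˡ-≤ t (bin-pos-below j k (≤-trans 1≤d (subst (d ≤_) e+d≡ (m≤n+m d e)))))
    e+a+t≡a+A : (e + a) + t ≡ a + A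
    e+a+t≡a+A = trans (xy∙z≈y∙xz e a t) (cong (a +_) e+t≡A)
    g+t≡b : g + t ≡ b
    g+t≡b = trans (+-assoc f a t) (trans (cong (f +_) a+t≡d) (trans (+-comm f d) d+f≡b))
    a+g+t≡b+a : (a + g) + t ≡ b + a
    a+g+t≡b+a = trans (+-assoc a g t) (trans (cong (a +_) g+t≡b) (+-comm a b))
    absorb : A + G f ≤ G g
    absorb = begin
      A + G f     ≤⟨ +-monoˡ-≤ (G f) (full-drop k (≤-trans (<⇒≤ a<d) d≤b)) ⟩
      G a + G f   ≡⟨ +-comm (G a) (G f) ⟩
      G f + G a   ≤⟨ superadditive k f a (m+n≤o⇒m≤o g (≤-reflexive g+t≡b)) ⟩
      G g         ∎

  -- Across at both levels (a < d = b + r): then e + b = A + e', and the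
  -- shorter tail b is handled by induction, the rest by (O) at level k+2 on
  -- {0,…,j} for the pair (e + b, e + r).
  tail-gap-across-across : ∀ k d → bin j (suc k) < d → bin j k < d →
    (∀ {d'} → d' < d → TailGapFor (suc k) d') → TailGapFor (suc k) d
  tail-gap-across-across k d a<d b<d ih e e' 1≤d e+d≡ e'+d≡ =
    +-cancelʳ-< ((A + T) + A) _ _ (begin-strict
    ((A + T) + G' e') + ((A + T) + A)     ≡⟨ cong₂ _+_ (cong ((A + T) +_) (upper-low k j e' e'≤a))
                                                       (cong ((A + T) +_) (sym G'a≡A)) ⟩
    ((A + T) + H e') + ((A + T) + G' a)   <⟨ +-monoʳ-< ((A + T) + H e') shorter ⟩
    ((A + T) + H e') + ((a + A) + Y)      ≡⟨ regroup₁ A T (H e') a Y ⟩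
    ((T + H e') + Y) + ((a + A) + A)      ≤⟨ +-monoˡ-≤ ((a + A) + A) step ⟩
    ((A + T) + K' e) + ((a + A) + A)      ≡⟨ regroup₂ A T (K' e) a ⟩
    ((a + A) + K' e) + ((A + T) + A)      ∎)
    where
    open ≤-Reasoning
    b = bin j k
    a = bin j (suc k)
    A = bin j (suc (suc k))
    T = bin j (suc (suc (suc k)))
    H = upper (suc k) j
    G' = upper (suc k) (suc j)
    K' = upper (suc (suc k)) (suc j)
    r = proj₁ (m≤n⇒∃[o]m+o≡n (<⇒≤ b<d))
    b+r≡d : b + r ≡ d
    b+r≡d = proj₂ (m≤n⇒∃[o]m+o≡n (<⇒≤ b<d))
    e'+r≡a : e' + r ≡ a
    e'+r≡a = +-cancelˡ-≡ b _ _ (trans (sym (x∙yz≈y∙xz e' b r)) (trans (cong (e' +_) b+r≡d) e'+d≡))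
    e'≤a : e' ≤ a
    e'≤a = m+n≤o⇒m≤o e' (≤-reflexive e'+r≡a)
    1≤b : 1 ≤ b
    1≤b = +-cancelʳ-≤ a 1 b (≤-trans a<d (subst (d ≤_) e'+d≡ (m≤n+m d e')))
    e+d≤ : ∀ {c} → c ≤ d → e + c ≤ a + A
    e+d≤ {c} c≤d = subst (e + c ≤_) e+d≡ (+-monoʳ-≤ e c≤d)
    e+r+b≡a+A : (e + r) + b ≡ a + A
    e+r+b≡a+A = trans (+-assoc e r b) (trans (cong (e +_) (trans (+-comm r b) b+r≡d)) e+d≡)
    e+b≡A+e' : e + b ≡ A + e'
    e+b≡A+e' = +-cancelʳ-≡ r _ _ (begin-equality
      (e + b) + r     ≡⟨ +-assoc e b r ⟩
      e + (b + r)     ≡⟨ cong (e +_) b+r≡d ⟩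
      e + d           ≡⟨ e+d≡ ⟩
      a + A           ≡⟨ cong (_+ A) (sym e'+r≡a) ⟩
      (e' + r) + A    ≡⟨ xy∙z≈zx∙y e' r A ⟩
      (A + e') + r    ∎)
    G'a≡A : G' a ≡ A
    G'a≡A = trans (upper-low k j a ≤-refl) (upper-full (suc k) j)
    Y = K' (e + r)
    shorter : (A + T) + G' a < (a + A) + Y
    shorter = ih b<d (e + r) a 1≤b e+r+b≡a+A (+-comm a b)
    e+b≤ : e + b ≤ a + A
    e+b≤ = e+d≤ (<⇒≤ b<d)
    e+r≤ : e + r ≤ a + A
    e+r≤ = e+d≤ (subst (r ≤_) b+r≡d (m≤n+m r b))
    regroup₀ : ∀ e b r → (e + b) + (e + r) ≡ (e + (b + r)) + e
    regroup₀ = solve-∀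
    sum≡ : (e + b) + (e + r) ≡ (a + A) + e
    sum≡ = trans (regroup₀ e b r) (cong (_+ e) (trans (cong (e +_) b+r≡d) e+d≡))
    step : (T + H e') + Y ≤ (A + T) + K' e
    step = begin
      (T + H e') + Y          ≡⟨ cong (_+ Y) (sym (trans (cong K' e+b≡A+e') (upper-high (suc k) j e'))) ⟩
      K' (e + b) + K' (e + r) ≤⟨ overflowⱼ₊₁ (suc (suc k)) (e + b) (e + r) e e+b≤ e+r≤ sum≡ ⟩
      (A + T) + K' e          ∎
    regroup₁ : ∀ A T h a y → ((A + T) + h) + ((a + A) + y) ≡ ((T + h) + y) + ((a + A) + A)
    regroup₁ = solve-∀
    regroup₂ : ∀ A T g a → ((A + T) + g) + ((a + A) + A) ≡ ((a + A) + g) + ((A + T) + A)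
    regroup₂ = solve-∀

  tail-gap-step : ∀ k → TailGap k (suc j)
  tail-gap-step zero    = tail-gap-0 (suc j)
  tail-gap-step (suc k) = <-rec (TailGapFor (suc k)) by-cases
    where
    by-cases : ∀ d → (∀ {d'} → d' < d → TailGapFor (suc k) d') → TailGapFor (suc k) d
    by-cases d ih with d ≤? bin j (suc k) | d ≤? bin j k
    ... | yes d≤a | yes d≤b = tail-gap-inside-inside k d d≤a d≤b
    ... | yes d≤a | no  d≰b = tail-gap-inside-across k d d≤a (≰⇒> d≰b)
    ... | no  d≰a | yes d≤b = tail-gap-across-inside k d (≰⇒> d≰a) d≤b ih
    ... | no  d≰a | no  d≰b = tail-gap-across-across k d (≰⇒> d≰a) (≰⇒> d≰b) ih

  invariant-step : Invariant (suc j)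
  invariant-step = record
    { superadditive  = superadditive-step
    ; strictOverflow = strict-overflow-step
    ; tailGap        = tail-gap-step
    }

invariant : ∀ j → Invariant j
invariant zero    = invariant-0
invariant (suc j) = Step.invariant-step j (invariant j)

canonical-upper : ∀ k c cs → CanonNE k (c ∷ cs) →
  repSum k (c ∷ cs) < bin (suc c) k × (∀ j → c < j → upper k j (repSum k (c ∷ cs)) ≡ repSum (suc k) (c ∷ cs))
canonical-tail : ∀ k c cs → CanonNE (suc k) (c ∷ cs) →
  repSum k cs < bin c k × upper k c (repSum k cs) ≡ repSum (suc k) cs

canonical-upper zero    c []      (() , _)
canonical-upper zero    c (_ ∷ _) (() , _)
canonical-upper (suc k) c cs canon = bound , evaluate
  where
  r = repSum k cs
  tail = canonical-tail k c cs canon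
  value : repSum (suc k) (c ∷ cs) ≡ bin c (suc k) + r
  value = cong (_+ r) (bin≡C c (suc k))
  bound : repSum (suc k) (c ∷ cs) < bin (suc c) (suc k)
  bound = subst (_< bin (suc c) (suc k)) (sym value)
    (subst (bin c (suc k) + r <_) (+-comm (bin c (suc k)) (bin c k)) (+-monoʳ-< (bin c (suc k)) (proj₁ tail)))
  evaluate : ∀ j → c < j → upper (suc k) j (repSum (suc k) (c ∷ cs)) ≡ repSum (suc (suc k)) (c ∷ cs)
  evaluate j c<j = begin
    upper (suc k) j (repSum (suc k) (c ∷ cs))     ≡⟨ upper-stable k c<j _ (<⇒≤ bound) ⟩
    upper (suc k) (suc c) (repSum (suc k) (c ∷ cs)) ≡⟨ cong (upper (suc k) (suc c)) value ⟩
    upper (suc k) (suc c) (bin c (suc k) + r)     ≡⟨ upper-high k c r ⟩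
    bin c (suc (suc k)) + upper k c r             ≡⟨ cong₂ _+_ (sym (bin≡C c (suc (suc k)))) (proj₂ tail) ⟩
    repSum (suc (suc k)) (c ∷ cs)                 ∎
    where open ≡-Reasoning

canonical-tail k c []       (_ , k<c)          = bin-pos (<⇒≤ k<c) , upper-zero k c
canonical-tail k c (b ∷ bs) (_ , b<c , canon) =
  ≤-trans (proj₁ next) (bin-mono k b<c) , proj₂ next c b<c
  where next = canonical-upper k b bs canon

top<ground : ∀ k b bs j → repSum k (b ∷ bs) < bin j k → b < j
top<ground k b bs j n<N = ≰⇒> λ j≤b → n≮n _ (≤-<-trans (≤-trans (bin-mono k j≤b) top≤n) n<N)
  where
  top≤n : bin b k ≤ repSum k (b ∷ bs)
  top≤n = subst (_≤ repSum k (b ∷ bs)) (bin≡C b k) (m≤m+n _ _)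

upper-canonical : ∀ k j n ns → IsCanonRep k n ns → n < bin j k → upper k j n ≡ repSum (suc k) ns
upper-canonical k j n []       refl            _   = upper-zero k j
upper-canonical k j n (b ∷ bs) (canon , refl) n<N =
  proj₂ (canonical-upper k b bs canon) j (top<ground k b bs j n<N)

-- Lemma 3.5: both summands lie below N = binom(j,k), so (O) at level k applies
-- to them and to the excess s = p + q - N, and upper k j turns all three
-- canonical representations into the sums of the statement.
lemma3p5 : (k p q j : ℕ) (c a : ℕ) (cs as bs : List ℕ) →
    1 ≤ k → 0 < p → 0 < q →
    IsCanonRep k p (c ∷ cs) → IsCanonRep k q (a ∷ as) →
    j > c → j > a →
    j C k ≤ p + q →
    IsCanonRep k ((p + q) ∸ (j C k)) bs →
    (j C (k + 1)) + repSum (k + 1) bs > repSum (k + 1) (c ∷ cs) + repSum (k + 1) (a ∷ as)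
lemma3p5 k p q j c a cs as bs _ _ _ rep-p@(canon-p , refl) rep-q@(canon-q , refl) c<j a<j N≤p+q rep-s
  rewrite +-comm k 1 | bin≡C j (suc k) = begin-strict
  repSum (suc k) (c ∷ cs) + repSum (suc k) (a ∷ as)
    ≡⟨ sym (cong₂ _+_ (upper-canonical k j p (c ∷ cs) rep-p p<N) (upper-canonical k j q (a ∷ as) rep-q q<N)) ⟩
  upper k j p + upper k j q
    <⟨ Invariant.strictOverflow (invariant j) k p q s p<N q<N p+q≡N+s ⟩
  bin j (suc k) + upper k j s
    ≡⟨ cong (bin j (suc k) +_) (upper-canonical k j s bs rep-s s<N) ⟩
  bin j (suc k) + repSum (suc k) bs ∎
  where
  open ≤-Reasoning
  N = bin j k
  s = (p + q) ∸ (j C k)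
  p<N : p < N
  p<N = ≤-trans (proj₁ (canonical-upper k c cs canon-p)) (bin-mono k c<j)
  q<N : q < N
  q<N = ≤-trans (proj₁ (canonical-upper k a as canon-q)) (bin-mono k a<j)
  p+q≡N+s : p + q ≡ N + s
  p+q≡N+s = trans (sym (m+[n∸m]≡n N≤p+q)) (cong (_+ s) (bin≡C j k))
  s<N : s < N
  s<N = +-cancelˡ-< N s N (subst (_< N + N) p+q≡N+s (+-mono-< p<N q<N))
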